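{- Consider the following data structure, for a directed graph $G=(V,E)$ with $m$ initial edges undergoing edge deletions, a fixed node $x$ and a fixed integer $h\ge1$. It stores a set $R(x)\subseteq V$, initialized to $V$ and modified only by the following procedure ApproximatePathUnion$(y)$, which may be called with any node $y$ at any time, interleaved with edge deletions (with $G$ the current graph): (1) Compute $B_1=\{v\in R(x): \mathrm{dist}_{G[R(x)]}(v,y)\le h\}$. (2) For $i=2,\dots,\lceil\log m\rceil+1$: compute $B_i=\{v\in R(x): \mathrm{dist}_{G[R(x)]}(v,y)\le ih\}$; if $|E(B_i)|\le 2|E(B_{i-1})|$, then compute $F=\{v\in B_i: \mathrm{dist}_{G[B_i]}(x,v)\le h\}$, set $X=B_{i-1}\setminus F$, replace $R(x)$ by $R(x)\setminus X$, and return $F$. Then every call of ApproximatePathUnion$(y)$ returns a set of nodes $F$ satisfying $\mathcal{P}(x,y,h,G)\subseteq F\subseteq \mathcal{P}(x,y,(\log m+3)h,G)$, where $G$ is the current graph at the time of the call.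
   Context: $\mathrm{dist}_H(u,v)$ is the directed unweighted shortest-path distance from $u$ to $v$ in graph $H$ ($\infty$ if unreachable). For $U\subseteq V$, $E(U)=E\cap U^2$ and $G[U]=(U,E(U))$ is the induced subgraph. Logarithms are base 2. The path union $\mathcal{P}(x,y,h,G)$ is the set of nodes lying on some path from $x$ to $y$ in $G$ with at most $h$ edges; equivalently $\{v\in V: \mathrm{dist}_G(x,v)+\mathrm{dist}_G(v,y)\le h\}$. -}

module Defs where

open import Data.Nat using (ℕ; zero; suc; _+_; _*_; _∸_; _^_; _≤_; _≤ᵇ_)
open import Data.Nat.Logarithm using (⌈log₂_⌉)
open import Data.Bool using (Bool; true; false; _∧_; _∨_; if_then_else_)
open import Data.Fin using (Fin; zero; suc; _≟_)
open import Data.Fin.Subset using (Subset; ⊤; _∩_; _─_)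
open import Data.Vec using (lookup; tabulate)
open import Data.Maybe using (Maybe; just; nothing)
open import Data.Product using (_×_; _,_; ∃-syntax)
open import Data.Sum using (_⊎_)
open import Data.List using (List; []; _∷_)
open import Relation.Nullary.Decidable using (⌊_⌋)
open import Relation.Binary.PropositionalEquality using (_≡_)

-- A directed graph on the node set V = Fin n, given by its adjacency
-- relation: G u v ≡ true iff (u , v) ∈ E.  (Self-loops are allowed.)
Graph : ℕ → Set
Graph n = Fin n → Fin n → Bool

anyFin : {n : ℕ} → (Fin n → Bool) → Bool
anyFin {zero} f = false
anyFin {suc n} f = f zero ∨ anyFin (λ w → f (suc w))

countFin : {n : ℕ} → (Fin n → Bool) → ℕ
countFin {zero} f = 0
countFin {suc n} f = (if f zero then 1 else 0) + countFin (λ w → f (suc w))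

-- distLe G U k u v  ≡ true  iff  dist_{G[U]}(u , v) ≤ k,
-- i.e. there is a path from u to v with at most k edges, all of whose
-- nodes lie in U (a walk of length ≤ k suffices, as it contains a path).
distLe : {n : ℕ} → Graph n → Subset n → ℕ → Fin n → Fin n → Bool
distLe G U zero u v = lookup U u ∧ ⌊ u ≟ v ⌋
distLe G U (suc k) u v =
  distLe G U zero u v ∨ (lookup U u ∧ anyFin (λ w → G u w ∧ distLe G U k w v))

sumFin : {n : ℕ} → (Fin n → ℕ) → ℕ
sumFin {zero} f = 0
sumFin {suc n} f = f zero + sumFin (λ w → f (suc w))

edgesIn : {n : ℕ} → Graph n → Subset n → ℕ
edgesIn G U = sumFin (λ u → countFin (λ v → lookup U u ∧ (lookup U v ∧ G u v)))

numEdges : {n : ℕ} → Graph n → ℕ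
numEdges G = edgesIn G ⊤

Dist : {n : ℕ} → Graph n → ℕ → Fin n → Fin n → Set
Dist G k u v = distLe G ⊤ k u v ≡ true

-- Generic path union: v with dist_G(x,v) + dist_G(v,y) ≤ bound,
-- where "≤ bound" is given as a predicate Bound on ℕ (downward closed).
-- Since at most the finite distances matter, dist(x,v)+dist(v,y) satisfies
-- Bound iff there are a, b with dist(x,v) ≤ a, dist(v,y) ≤ b, Bound (a+b).
InPathUnionBy : {n : ℕ} → (ℕ → Set) → Fin n → Fin n → Graph n → Fin n → Set
InPathUnionBy Bound x y G v =
  ∃[ a ] ∃[ b ] (Bound (a + b) × Dist G a x v × Dist G b v y)

InPathUnion : {n : ℕ} → Fin n → Fin n → ℕ → Graph n → Fin n → Set
InPathUnion x y h G = InPathUnionBy (λ d → d ≤ h) x y G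

-- d ≤ (log₂ m + 3) h  for a natural number d (and m ≥ 1), written without
-- reals:  d ≤ 3h, or  d - 3h ≤ h·log₂ m  ⇔  2^(d ∸ 3h) ≤ m^h.
LeLogBound : ℕ → ℕ → ℕ → Set
LeLogBound m h d = d ≤ 3 * h ⊎ 2 ^ (d ∸ 3 * h) ≤ m ^ h

InPathUnionLog : {n : ℕ} → Fin n → Fin n → ℕ → ℕ → Graph n → Fin n → Set
InPathUnionLog x y m h G = InPathUnionBy (LeLogBound m h) x y G

ball : {n : ℕ} → Graph n → Subset n → Fin n → ℕ → Subset n
ball G R y k = tabulate (λ v → lookup R v ∧ distLe G R k v y)

-- The loop of ApproximatePathUnion(y): iteration i with Bprev = B_{i-1},
-- fuel = number of remaining iterations.  Returns (F , new R(x)), or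
-- nothing if the loop ends without returning.
apuLoop : {n : ℕ} → Graph n → Fin n → ℕ → Subset n → Fin n →
          ℕ → ℕ → Subset n → Maybe (Subset n × Subset n)
apuLoop G x h R y i zero Bprev = nothing
apuLoop G x h R y i (suc fuel) Bprev =
  if edgesIn G Bi ≤ᵇ 2 * edgesIn G Bprev
  then just (F , R ─ (Bprev ─ F))
  else apuLoop G x h R y (suc i) fuel Bi
  where
  Bi : Subset _
  Bi = ball G R y (i * h)
  F : Subset _
  F = tabulate (λ v → lookup Bi v ∧ distLe G Bi h x v)

-- ApproximatePathUnion(y) on current graph G and current R = R(x), where
-- m is the initial number of edges: i ranges over 2 , … , ⌈log m⌉ + 1.
approximatePathUnion : {n : ℕ} → ℕ → Graph n → Fin n → ℕ → Subset n →
                       Fin n → Maybe (Subset n × Subset n)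
approximatePathUnion m G x h R y =
  apuLoop G x h R y 2 ⌈log₂ m ⌉ (ball G R y h)

data Op (n : ℕ) : Set where
  delete : Fin n → Fin n → Op n
  call   : Fin n → Op n

deleteEdge : {n : ℕ} → Graph n → Fin n → Fin n → Graph n
deleteEdge G u v a b = if ⌊ a ≟ u ⌋ ∧ ⌊ b ≟ v ⌋ then false else G a b

run : {n : ℕ} → ℕ → Fin n → ℕ → Graph n → Subset n → List (Op n) →
      Graph n × Subset n
run m x h G R [] = G , R
run m x h G R (delete u v ∷ ops) = run m x h (deleteEdge G u v) R ops
run m x h G R (call y ∷ ops) with approximatePathUnion m G x h R y
... | just (F , R') = run m x h G R' ops
... | nothing       = run m x h G R ops

-- The algorithm maintains the invariant that R(x) contains every node within
-- distance h of x.  It survives edge deletions (distances only grow) and calls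
-- (a removed node of B_{i-1} at distance ≤ h from x would lie in F, since the
-- path to it stays inside B_i), and it makes every h-hop x–y path, hence every
-- node of 𝒫(x, y, h, G), lie in G[B_i] close enough to x to be put in F.
-- Conversely F ⊆ B_i consists of nodes v with dist(x, v) ≤ h and
-- dist(v, y) ≤ i h, where i ≤ ⌈log m⌉ + 1.  Finally the loop does return:
-- each failing test doubles |E(B_i)|, which cannot happen ⌈log m⌉ times in a
-- row once E(B_1) ≠ ∅, while E(B_1) = ∅ forces E(B_2) = ∅ as every edge of
-- some G[B_i] yields an edge of G[R(x)] into y.
module Submission where

open import Defs
open import Data.Bool using (Bool; true; false; _∧_; _∨_; if_then_else_; T)
open import Data.Bool.Properties using (∧-conicalˡ; ∧-conicalʳ; ∨-zeroʳ; T-≡)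
open import Data.Empty using (⊥-elim)
open import Data.Fin using (Fin; zero; suc; _≟_)
open import Data.Fin.Subset using (Subset; ⊤; _∈_; _⊆_; _─_)
open import Data.Fin.Subset.Properties using (∈⊤; ⊆-refl; drop-there)
open import Data.List using (List; []; _∷_)
open import Data.Maybe using (just)
open import Data.Nat
  using (ℕ; zero; suc; _+_; _*_; _∸_; _^_; _≤_; _<_; _≤ᵇ_; z≤n; z<s; s≤s; ⌊_/2⌋; ⌈_/2⌉; >-nonZero)
open import Data.Nat.Induction using (<-rec)
open import Data.Nat.Logarithm using (⌈log₂_⌉; ⌈log₂⌉-mono-≤; ⌈log₂⌈n/2⌉⌉≡⌈log₂n⌉∸1; ⌈log₂2^n⌉≡n)
open import Data.Nat.Properties hiding (_≟_)
open import Data.Product using (_×_; _,_; ∃-syntax; proj₁; proj₂)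
open import Data.Sum using (_⊎_; inj₁; inj₂)
open import Data.Unit using (tt)
open import Data.Vec using (_∷_; lookup; tabulate; here; there)
open import Data.Vec.Properties using (lookup∘tabulate; []=⇒lookup; lookup⇒[]=)
open import Function using (_∘_; Equivalence)
open import Relation.Binary.PropositionalEquality
  using (_≡_; refl; sym; trans; cong; cong₂; subst)
open import Relation.Nullary using (yes; no; ¬_)
open import Relation.Nullary.Decidable using (⌊_⌋; toWitness; isYes≗does; dec-true)

private
  variable
    n a b k k′ : ℕ
    u v w x y : Fin n
    G G′ : Graph n
    S U : Subset n

∧-true⁻ : ∀ p {q} → p ∧ q ≡ true → p ≡ true × q ≡ true
∧-true⁻ p r = ∧-conicalˡ p _ r , ∧-conicalʳ p _ r

∨-true⁻ : ∀ {p q} → p ∨ q ≡ true → p ≡ true ⊎ q ≡ true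
∨-true⁻ {true} _ = inj₁ refl
∨-true⁻ {false} q = inj₂ q

∨-trueʳ : ∀ p {q} → q ≡ true → p ∨ q ≡ true
∨-trueʳ p refl = ∨-zeroʳ p

⌊≟⌋-refl : (u : Fin n) → ⌊ u ≟ u ⌋ ≡ true
⌊≟⌋-refl u = trans (isYes≗does (u ≟ u)) (dec-true (u ≟ u) refl)

⌊≟⌋⇒≡ : ⌊ u ≟ v ⌋ ≡ true → u ≡ v
⌊≟⌋⇒≡ p = toWitness (Equivalence.from T-≡ p)

∈-tabulate⁺ : {f : Fin n → Bool} → f u ≡ true → u ∈ tabulate f
∈-tabulate⁺ {u = u} {f} p = lookup⇒[]= u _ (trans (lookup∘tabulate f u) p)

∈-tabulate⁻ : {f : Fin n → Bool} → u ∈ tabulate f → f u ≡ true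
∈-tabulate⁻ {u = u} {f = f} p = trans (sym (lookup∘tabulate f u)) ([]=⇒lookup p)

x∈p─[q─r] : ∀ {p q r : Subset n} → x ∈ p → (x ∈ q → x ∈ r) → x ∈ p ─ (q ─ r)
x∈p─[q─r] {q = false ∷ _} {false ∷ _} here _ = here
x∈p─[q─r] {q = false ∷ _} {true ∷ _} here _ = here
x∈p─[q─r] {q = true ∷ _} {_ ∷ _} here qr with qr here
... | here = here
x∈p─[q─r] {q = _ ∷ _} {_ ∷ _} (there xp) qr = there (x∈p─[q─r] xp (drop-there ∘ qr ∘ there))

anyFin⁺ : (f : Fin n → Bool) → f w ≡ true → anyFin f ≡ true
anyFin⁺ {w = zero} f p = cong (_∨ anyFin (f ∘ suc)) p
anyFin⁺ {w = suc w} f p = ∨-trueʳ (f zero) (anyFin⁺ (f ∘ suc) p)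

anyFin⁻ : (f : Fin n → Bool) → anyFin f ≡ true → ∃[ w ] f w ≡ true
anyFin⁻ {suc n} f p with ∨-true⁻ p
... | inj₁ p₀ = zero , p₀
... | inj₂ p₁ with anyFin⁻ (f ∘ suc) p₁
... | w , q = suc w , q

countFin-mono : (f g : Fin n → Bool) → (∀ w → f w ≡ true → g w ≡ true) → countFin f ≤ countFin g
countFin-mono {zero} _ _ _ = z≤n
countFin-mono {suc n} f g f⇒g = +-mono-≤ head (countFin-mono (f ∘ suc) (g ∘ suc) (f⇒g ∘ suc))
  where
  head : (if f zero then 1 else 0) ≤ (if g zero then 1 else 0)
  head with f zero | g zero | f⇒g zero
  ... | true  | true  | _ = ≤-refl
  ... | true  | false | p with p refl
  ... | ()
  head | false | _ | _ = z≤n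

0<countFin⁺ : (f : Fin n → Bool) → f w ≡ true → 0 < countFin f
0<countFin⁺ {w = zero} f p rewrite p = s≤s z≤n
0<countFin⁺ {w = suc w} f p = ≤-trans (0<countFin⁺ (f ∘ suc) p) (m≤n+m _ (if f zero then 1 else 0))

0<countFin⁻ : (f : Fin n → Bool) → 0 < countFin f → ∃[ w ] f w ≡ true
0<countFin⁻ {suc n} f p with f zero in eq
... | true = zero , eq
... | false with 0<countFin⁻ (f ∘ suc) p
... | w , q = suc w , q

sumFin-mono : (s t : Fin n → ℕ) → (∀ w → s w ≤ t w) → sumFin s ≤ sumFin t
sumFin-mono {zero} _ _ _ = z≤n
sumFin-mono {suc n} s t s≤t = +-mono-≤ (s≤t zero) (sumFin-mono (s ∘ suc) (t ∘ suc) (s≤t ∘ suc))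

0<sumFin⁺ : (s : Fin n → ℕ) → 0 < s w → 0 < sumFin s
0<sumFin⁺ {w = zero} s p = ≤-trans p (m≤m+n _ _)
0<sumFin⁺ {w = suc w} s p = ≤-trans (0<sumFin⁺ (s ∘ suc) p) (m≤n+m _ (s zero))

0<sumFin⁻ : (s : Fin n → ℕ) → 0 < sumFin s → ∃[ w ] 0 < s w
0<sumFin⁻ {suc n} s p with s zero in eq
... | suc _ = zero , subst (0 <_) (sym eq) z<s
... | zero with 0<sumFin⁻ (s ∘ suc) p
... | w , q = suc w , q

_⊆ᴳ_ : Graph n → Graph n → Set
G ⊆ᴳ G′ = ∀ {u v} → G u v ≡ true → G′ u v ≡ true

deleteEdge-⊆ᴳ : ∀ (G : Graph n) u v → deleteEdge G u v ⊆ᴳ G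
deleteEdge-⊆ᴳ G u v {a} {b} p with ⌊ a ≟ u ⌋ ∧ ⌊ b ≟ v ⌋
... | false = p

isEdgeIn : Graph n → Subset n → Fin n → Fin n → Bool
isEdgeIn G U u v = lookup U u ∧ (lookup U v ∧ G u v)

isEdgeIn⁺ : ∀ G → u ∈ U → v ∈ U → G u v ≡ true → isEdgeIn G U u v ≡ true
isEdgeIn⁺ G Uu Uv e = cong₂ _∧_ ([]=⇒lookup Uu) (cong₂ _∧_ ([]=⇒lookup Uv) e)

isEdgeIn⁻ : ∀ G U → isEdgeIn {n} G U u v ≡ true → u ∈ U × v ∈ U × G u v ≡ true
isEdgeIn⁻ {u = u} {v} G U p with ∧-true⁻ (lookup U u) p
... | Uu , q with ∧-true⁻ (lookup U v) q
... | Uv , e = lookup⇒[]= u U Uu , lookup⇒[]= v U Uv , e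

edgesIn-mono : G ⊆ᴳ G′ → U ⊆ S → edgesIn G U ≤ edgesIn G′ S
edgesIn-mono {G = G} {G′} {U} {S} G⊆G′ U⊆S =
  sumFin-mono _ _ λ u → countFin-mono (isEdgeIn G U u) (isEdgeIn G′ S u) λ v p →
    let Uu , Uv , e = isEdgeIn⁻ G U p in isEdgeIn⁺ G′ (U⊆S Uu) (U⊆S Uv) (G⊆G′ e)

edgesIn≤numEdges : ∀ (G : Graph n) U → edgesIn G U ≤ numEdges G
edgesIn≤numEdges G U = edgesIn-mono {G = G} {U = U} {S = ⊤} (λ e → e) (λ _ → ∈⊤)

numEdges-deleteEdge : ∀ (G : Graph n) u v → numEdges (deleteEdge G u v) ≤ numEdges G
numEdges-deleteEdge G u v = edgesIn-mono {G = deleteEdge G u v} {G} {⊤} (deleteEdge-⊆ᴳ G u v) ⊆-refl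

edgesIn-pos⁺ : u ∈ U → v ∈ U → G u v ≡ true → 0 < edgesIn G U
edgesIn-pos⁺ {u = u} {U = U} {G = G} Uu Uv e =
  0<sumFin⁺ (λ u → countFin (isEdgeIn G U u)) (0<countFin⁺ (isEdgeIn G U u) (isEdgeIn⁺ G Uu Uv e))

edgesIn-pos⁻ : 0 < edgesIn G U → ∃[ u ] ∃[ v ] u ∈ U × v ∈ U × G u v ≡ true
edgesIn-pos⁻ {G = G} {U = U} p with 0<sumFin⁻ (λ u → countFin (isEdgeIn G U u)) p
... | u , q with 0<countFin⁻ (isEdgeIn G U u) q
... | v , r = u , v , isEdgeIn⁻ G U r

data Walk (G : Graph n) (U : Subset n) : ℕ → Fin n → Fin n → Set where
  [_]  : ∀ {k u} → u ∈ U → Walk G U k u u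
  step : ∀ {k u w v} → G u w ≡ true → u ∈ U → Walk G U k w v → Walk G U (suc k) u v

source : Walk G U k u v → u ∈ U
source [ Uu ] = Uu
source (step _ Uu _) = Uu

target : Walk G U k u v → v ∈ U
target [ Uv ] = Uv
target (step _ _ p) = target p

stay⁺ : ∀ G → u ∈ U → distLe G U zero u u ≡ true
stay⁺ {u = u} G Uu = cong₂ _∧_ ([]=⇒lookup Uu) (⌊≟⌋-refl u)

stay⁻ : distLe G U zero u v ≡ true → Walk G U k u v
stay⁻ {U = U} {u = u} p with ∧-true⁻ (lookup U u) p
... | Uu , u≟v with ⌊≟⌋⇒≡ u≟v
... | refl = [ lookup⇒[]= u U Uu ]

Walk⇒distLe : Walk G U k u v → distLe G U k u v ≡ true
Walk⇒distLe {G = G} {k = zero} [ Uu ] = stay⁺ G Uu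
Walk⇒distLe {G = G} {U} {suc k} {u} [ Uu ] =
  cong (_∨ (lookup U u ∧ anyFin (λ w → G u w ∧ distLe G U k w u))) (stay⁺ G Uu)
Walk⇒distLe {G = G} {U = U} {u = u} {v = v} (step {k = k} {w = w} e Uu p) =
  ∨-trueʳ (distLe G U zero u v)
    (cong₂ _∧_ ([]=⇒lookup Uu)
      (anyFin⁺ (λ w → G u w ∧ distLe G U k w v) (cong₂ _∧_ e (Walk⇒distLe p))))

distLe⇒Walk : distLe G U k u v ≡ true → Walk G U k u v
distLe⇒Walk {k = zero} p = stay⁻ p
distLe⇒Walk {G = G} {U} {suc k} {u} {v} p with ∨-true⁻ {distLe G U zero u v} p
... | inj₁ q = stay⁻ q
... | inj₂ q with ∧-true⁻ (lookup U u) q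
... | Uu , r with anyFin⁻ (λ w → G u w ∧ distLe G U k w v) r
... | w , s with ∧-true⁻ (G u w) s
... | e , t = step e (lookup⇒[]= u U Uu) (distLe⇒Walk t)

weaken : k ≤ k′ → Walk G U k u v → Walk G U k′ u v
weaken _ [ Uu ] = [ Uu ]
weaken (s≤s k≤k′) (step e Uu p) = step e Uu (weaken k≤k′ p)

_++_ : Walk G U a u w → Walk G U b w v → Walk G U (a + b) u v
_++_ {a = a} {b = b} [ _ ] q = weaken (m≤n+m b a) q
step e Uu p ++ q = step e Uu (p ++ q)

Walk-mono : G ⊆ᴳ G′ → Walk G U k u v → Walk G′ U k u v
Walk-mono G⊆G′ [ Uu ] = [ Uu ]
Walk-mono G⊆G′ (step e Uu p) = step (G⊆G′ e) Uu (Walk-mono G⊆G′ p)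

restrictFrom : (∀ {z} → Walk G S k u z → z ∈ U) → Walk G S k u v → Walk G U k u v
restrictFrom inU [ Su ] = [ inU [ Su ] ]
restrictFrom inU (step e Su p) = step e (inU [ Su ]) (restrictFrom (inU ∘ step e Su) p)

restrictTo : (∀ {z} → Walk G S k z v → z ∈ U) → Walk G S k u v → Walk G U k u v
restrictTo inU [ Sv ] = [ inU [ Sv ] ]
restrictTo inU p@(step e _ q) = step e (inU p) (restrictTo (inU ∘ weaken (n≤1+n _)) q)

lastEdge : G u w ≡ true → u ∈ U → Walk G U k w v → ∃[ q ] q ∈ U × G q v ≡ true
lastEdge e Uu [ _ ] = _ , Uu , e
lastEdge _ _ (step e Uw p) = lastEdge e Uw p

1≤⌈log₂⌉ : ∀ {m} → 2 ≤ m → 1 ≤ ⌈log₂ m ⌉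
1≤⌈log₂⌉ = ⌈log₂⌉-mono-≤

m≤2^⌈log₂m⌉ : ∀ m → m ≤ 2 ^ ⌈log₂ m ⌉
m≤2^⌈log₂m⌉ = <-rec _ bound
  where
  bound : ∀ m → (∀ {k} → k < m → k ≤ 2 ^ ⌈log₂ k ⌉) → m ≤ 2 ^ ⌈log₂ m ⌉
  bound zero _ = z≤n
  bound (suc zero) _ = s≤s z≤n
  bound m@(suc (suc j)) rec = begin
    m                                 ≡⟨ ⌊n/2⌋+⌈n/2⌉≡n m ⟨
    ⌊ m /2⌋ + ⌈ m /2⌉                 ≤⟨ +-monoˡ-≤ ⌈ m /2⌉ (⌊n/2⌋≤⌈n/2⌉ m) ⟩
    ⌈ m /2⌉ + ⌈ m /2⌉                 ≤⟨ +-mono-≤ half half ⟩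
    2 ^ (c ∸ 1) + 2 ^ (c ∸ 1)         ≡⟨ cong (2 ^ (c ∸ 1) +_) (+-identityʳ _) ⟨
    2 ^ (1 + (c ∸ 1))                 ≡⟨ cong (2 ^_) (m+[n∸m]≡n (1≤⌈log₂⌉ {m} (s≤s (s≤s z≤n)))) ⟩
    2 ^ c                             ∎
    where
    open ≤-Reasoning
    c = ⌈log₂ m ⌉
    half : ⌈ m /2⌉ ≤ 2 ^ (c ∸ 1)
    half = subst (λ e → ⌈ m /2⌉ ≤ 2 ^ e) (⌈log₂⌈n/2⌉⌉≡⌈log₂n⌉∸1 m) (rec (⌈n/2⌉<n j))

<⌈log₂⌉⇒2^< : ∀ {c m} → suc c ≤ ⌈log₂ m ⌉ → 2 ^ c < m
<⌈log₂⌉⇒2^< {c} {m} c<log = ≰⇒> λ m≤2^c →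
  n≮n c (≤-trans c<log (subst (⌈log₂ m ⌉ ≤_) (⌈log₂2^n⌉≡n c) (⌈log₂⌉-mono-≤ m≤2^c)))

≤-LeLogBound : ∀ {m h} d → 2 ^ (d ∸ 3) ≤ m → LeLogBound m h (d * h)
≤-LeLogBound {m} {h} d 2^d∸3≤m = inj₂ (begin
  2 ^ (d * h ∸ 3 * h)    ≡⟨ cong (2 ^_) (*-distribʳ-∸ h d 3) ⟨
  2 ^ ((d ∸ 3) * h)      ≡⟨ ^-*-assoc 2 (d ∸ 3) h ⟨
  (2 ^ (d ∸ 3)) ^ h      ≤⟨ ^-monoˡ-≤ h 2^d∸3≤m ⟩
  m ^ h                  ∎)
  where open ≤-Reasoning

doubling : ∀ {M} f c {d} → M ≤ 2 ^ suc f * c → 2 * c < d → M < 2 ^ f * d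
doubling {M} f c {d} M≤ 2c<d = begin-strict
  M                 ≤⟨ M≤ ⟩
  2 * 2 ^ f * c     ≡⟨ cong (_* c) (*-comm 2 (2 ^ f)) ⟩
  2 ^ f * 2 * c     ≡⟨ *-assoc (2 ^ f) 2 c ⟩
  2 ^ f * (2 * c)   <⟨ *-monoʳ-< (2 ^ f) {{m^n≢0 2 f}} 2c<d ⟩
  2 ^ f * d         ∎
  where open ≤-Reasoning

OutBall⊆ : Graph n → Fin n → ℕ → Subset n → Set
OutBall⊆ G x h R = ∀ {v} → Walk G ⊤ h x v → v ∈ R

module ApproximatePathUnion (G : Graph n) (x : Fin n) (h : ℕ) (R : Subset n) (y : Fin n) where

  B : ℕ → Subset n
  B = ball G R y

  F : ℕ → Subset n
  F k = tabulate (λ v → lookup (B k) v ∧ distLe G (B k) h x v)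

  ∈B⁺ : Walk G R k v y → v ∈ B k
  ∈B⁺ p = ∈-tabulate⁺ (cong₂ _∧_ ([]=⇒lookup (source p)) (Walk⇒distLe p))

  ∈B⁻ : v ∈ B k → Walk G R k v y
  ∈B⁻ {v = v} p = distLe⇒Walk (proj₂ (∧-true⁻ (lookup R v) (∈-tabulate⁻ p)))

  ∈F⁺ : Walk G (B k) h x v → v ∈ F k
  ∈F⁺ p = ∈-tabulate⁺ (cong₂ _∧_ ([]=⇒lookup (target p)) (Walk⇒distLe p))

  ∈F⁻ : v ∈ F k → Walk G (B k) h x v
  ∈F⁻ {v = v} {k} p = distLe⇒Walk (proj₂ (∧-true⁻ (lookup (B k) v) (∈-tabulate⁻ p)))

  walks⇒∈F : Walk G R a x v → a ≤ h → Walk G R b v y → a + b ≤ k → v ∈ F k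
  walks⇒∈F {k = k} xv a≤h vy a+b≤k =
    ∈F⁺ {k = k} (weaken a≤h (restrictTo (λ zv → ∈B⁺ {k = k} (weaken a+b≤k (zv ++ vy))) xv))

  complete : ∀ j → OutBall⊆ G x h R → InPathUnion x y h G v → v ∈ F (suc j * h)
  complete j cov (a , b , a+b≤h , xv , vy) =
    walks⇒∈F xvᴿ a≤h vyᴿ (≤-trans a+b≤h (m≤m+n h (j * h)))
    where
    a≤h = ≤-trans (m≤m+n a b) a+b≤h
    xvᴿ = restrictFrom (cov ∘ weaken a≤h) (distLe⇒Walk xv)
    vyᴿ = restrictFrom (λ vz → cov (weaken a+b≤h (distLe⇒Walk xv ++ vz))) (distLe⇒Walk vy)

  sound : ∀ {m j} → 2 ≤ m → j ≤ ⌈log₂ m ⌉ → v ∈ F (suc j * h) → InPathUnionLog x y m h G v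
  sound {m = m} {j} 2≤m j≤log v∈F =
    h , suc j * h , ≤-LeLogBound {h = h} (suc (suc j)) (2^[j∸1]≤m j j≤log) ,
    Walk⇒distLe (restrictFrom (λ _ → ∈⊤) xv) ,
    Walk⇒distLe (restrictFrom (λ _ → ∈⊤) (∈B⁻ {k = suc j * h} (target xv)))
    where
    xv = ∈F⁻ {k = suc j * h} v∈F
    2^[j∸1]≤m : ∀ j → j ≤ ⌈log₂ m ⌉ → 2 ^ (j ∸ 1) ≤ m
    2^[j∸1]≤m zero _ = ≤-trans (s≤s z≤n) 2≤m
    2^[j∸1]≤m (suc j) j<log = <⇒≤ (<⌈log₂⌉⇒2^< j<log)

  preserve : ∀ j → OutBall⊆ G x h R → OutBall⊆ G x h (R ─ (B (j * h) ─ F (suc j * h)))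
  preserve j cov xv = x∈p─[q─r] (cov xv) λ v∈B →
    walks⇒∈F (restrictFrom cov xv) ≤-refl (∈B⁻ {k = j * h} v∈B) ≤-refl

  edgesB : ℕ → ℕ
  edgesB k = edgesIn G (B k)

  result : ℕ → Subset n × Subset n
  result j = F (suc j * h) , R ─ (B (j * h) ─ F (suc j * h))

  loop-stops : ∀ i f → edgesB (suc i * h) ≤ 2 * edgesB (i * h) →
               apuLoop G x h R y (suc i) (suc f) (B (i * h)) ≡ just (result i)
  loop-stops i f le with edgesIn G (B (suc i * h)) ≤ᵇ 2 * edgesIn G (B (i * h)) in eq
  ... | true = refl
  ... | false = ⊥-elim (subst T eq (≤⇒≤ᵇ le))

  loop-continues : ∀ i f → ¬ edgesB (suc i * h) ≤ 2 * edgesB (i * h) →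
                   apuLoop G x h R y (suc i) (suc f) (B (i * h)) ≡
                   apuLoop G x h R y (suc (suc i)) f (B (suc i * h))
  loop-continues i f gt with edgesIn G (B (suc i * h)) ≤ᵇ 2 * edgesIn G (B (i * h)) in eq
  ... | true = ⊥-elim (gt (≤ᵇ⇒≤ _ _ (subst T (sym eq) tt)))
  ... | false = refl

  edgesB-pos : ∀ k {r} → 1 ≤ r → 0 < edgesB k → 0 < edgesB r
  edgesB-pos k {r} 1≤r pos with edgesIn-pos⁻ pos
  ... | u , w , u∈B , w∈B , uw with ∈B⁻ {k = k} w∈B
  ... | wy with lastEdge uw (source (∈B⁻ {k = k} u∈B)) wy
  ... | q , q∈R , qy =
    edgesIn-pos⁺ (∈B⁺ {k = r} (weaken 1≤r (step qy q∈R [ target wy ])))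
                 (∈B⁺ {k = r} [ target wy ]) qy

  -- The potential 2 ^ (suc f) * |E(B (i h))| stays ≥ |E| while the test fails.
  loop : ∀ f i → numEdges G ≤ 2 ^ suc f * edgesB (i * h) →
         ∃[ j ] j ≤ i + f × apuLoop G x h R y (suc i) (suc f) (B (i * h)) ≡ just (result j)
  loop f i M≤ with edgesB (suc i * h) ≤? 2 * edgesB (i * h)
  ... | yes stop = i , m≤m+n i f , loop-stops i f stop
  loop zero i M≤ | no grow =
    ⊥-elim (<⇒≱ (subst (numEdges G <_) (*-identityˡ _) (doubling 0 (edgesB (i * h)) M≤ (≰⇒> grow)))
                 (edgesIn≤numEdges G (B (suc i * h))))
  loop (suc f) i M≤ | no grow
    with loop f (suc i) (<⇒≤ (doubling (suc f) (edgesB (i * h)) M≤ (≰⇒> grow)))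
  ... | j , j≤ , eq =
    j , subst (j ≤_) (sym (+-suc i f)) j≤ , trans (loop-continues i (suc f) grow) eq

  search : 1 ≤ h → ∀ f → numEdges G ≤ 2 ^ suc f →
           ∃[ j ] j ≤ suc f × apuLoop G x h R y 2 (suc f) (B (1 * h)) ≡ just (result j)
  search 1≤h f M≤ with 0 <? edgesB (1 * h)
  ... | yes pos = loop f 1 (≤-trans M≤ (m≤m*n _ _ {{>-nonZero pos}}))
  ... | no ¬pos = 1 , s≤s z≤n , loop-stops 1 f (≤-trans (≮⇒≥ no-edges) z≤n)
    where no-edges = ¬pos ∘ edgesB-pos (2 * h) (*-monoʳ-≤ 1 1≤h)

  returns : ∀ {m} → 1 ≤ h → 2 ≤ m → numEdges G ≤ m →
            ∃[ j ] j ≤ ⌈log₂ m ⌉ × approximatePathUnion m G x h R y ≡ just (result j)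
  returns {m} 1≤h 2≤m M≤m =
    let j , j≤ , eq = search 1≤h (⌈log₂ m ⌉ ∸ 1) (subst (λ c → numEdges G ≤ 2 ^ c) (sym c≡) M≤2^c)
    in j , subst (j ≤_) c≡ j≤ ,
       trans (cong₂ (apuLoop G x h R y 2) (sym c≡) (cong B (sym (*-identityˡ h)))) eq
    where
    c≡ : suc (⌈log₂ m ⌉ ∸ 1) ≡ ⌈log₂ m ⌉
    c≡ = m+[n∸m]≡n (1≤⌈log₂⌉ 2≤m)
    M≤2^c : numEdges G ≤ 2 ^ ⌈log₂ m ⌉
    M≤2^c = ≤-trans M≤m (m≤2^⌈log₂m⌉ m)

  spec : ∀ {m} → 1 ≤ h → 2 ≤ m → numEdges G ≤ m → OutBall⊆ G x h R →
    ∃[ F′ ] ∃[ R′ ] (approximatePathUnion m G x h R y ≡ just (F′ , R′))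
      × (∀ v → InPathUnion x y h G v → v ∈ F′)
      × (∀ v → v ∈ F′ → InPathUnionLog x y m h G v)
      × OutBall⊆ G x h R′
  spec 1≤h 2≤m M≤m cov =
    let j , j≤ , eq = returns 1≤h 2≤m M≤m
    in _ , _ , eq , (λ _ → complete j cov) , (λ _ → sound 2≤m j≤) , preserve j cov

Valid : ℕ → Fin n → ℕ → Graph n × Subset n → Set
Valid m x h (G , R) = numEdges G ≤ m × OutBall⊆ G x h R

run-valid : ∀ {m h} → 1 ≤ h → 2 ≤ m → ∀ ops (G : Graph n) R →
            Valid m x h (G , R) → Valid m x h (run m x h G R ops)
run-valid 1≤h 2≤m [] G R valid = valid
run-valid 1≤h 2≤m (delete u v ∷ ops) G R (M≤m , cov) =
  run-valid 1≤h 2≤m ops (deleteEdge G u v) R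
    (≤-trans (numEdges-deleteEdge G u v) M≤m , cov ∘ Walk-mono (deleteEdge-⊆ᴳ G u v))
run-valid {x = x} {m} {h} 1≤h 2≤m (call y ∷ ops) G R (M≤m , cov)
  with ApproximatePathUnion.spec G x h R y 1≤h 2≤m M≤m cov
... | _ , R′ , eq , _ , _ , cov′ rewrite eq = run-valid 1≤h 2≤m ops G R′ (M≤m , cov′)

lemma3p3 : {n : ℕ} (G₀ : Graph n) (x : Fin n) (h : ℕ) → 1 ≤ h →
  2 ≤ numEdges G₀ →
  (ops : List (Op n)) (y : Fin n) →
  let m = numEdges G₀
      S = run m x h G₀ ⊤ ops
      G = proj₁ S
      R = proj₂ S
  in ∃[ F ] ∃[ R' ]
       ((approximatePathUnion m G x h R y ≡ just (F , R'))
        × (∀ v → InPathUnion x y h G v → v ∈ F)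
        × (∀ v → v ∈ F → InPathUnionLog x y m h G v))
lemma3p3 G₀ x h 1≤h 2≤m ops y =
  let M≤m , cov = run-valid 1≤h 2≤m ops G₀ ⊤ (≤-refl , λ _ → ∈⊤)
      F , R′ , eq , complete , sound , _ =
        ApproximatePathUnion.spec (proj₁ state) x h (proj₂ state) y 1≤h 2≤m M≤m cov
  in F , R′ , eq , complete , sound
  where
  state : Graph _ × Subset _
  state = run (numEdges G₀) x h G₀ ⊤ ops
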